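{- Let $q$ be a positive integer such that $2q=s'^2+3r'^2$ for some $r',s'\in\mathbb{Z}$, and let $A,B$ be integers such that $q$ divides $A^2+3B^2$. Then there exist integers $r,s$ with $2q=s^2+3r^2$ such that $$Ar+Bs\equiv 0 \pmod{2q}\qquad\text{and}\qquad As-3Br\equiv 0\pmod{2q}.$$ -}

module Defs where

{-# OPTIONS --safe #-}
module Submission where

-- Work in the Euclidean ring ℤ[ω] of Eisenstein integers, which contains ℤ[√-3] with
-- √-3 = 1 + 2ω.  Put α = A + B√-3 and β = s′ + r′√-3, so that N β = 2q divides 2 N α.
-- If g is a gcd of α and β, with α = a g and β = b g, then a and b are coprime and
-- N b ∣ 2 N a.  As 2 is prime in ℤ[ω] and cannot divide both a and b, b divides conj a,
-- hence δ = conj b · g is a divisor of α of norm 2q.  Moving a unit between the two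
-- factors puts both α/δ and δ into ℤ[√-3]; writing conj δ = s + r√-3 we get
-- 2q = N δ = s² + 3r², and α · conj δ = 2q · (α/δ) lies in 2q ℤ[√-3].  As its
-- coordinates are A s - 3 B r and A r + B s, both congruences follow.

open import Defs
open import Data.Nat using (ℕ)
open import Data.Integer using (ℤ; +_; _+_; _-_; _*_; _>_)
open import Data.Integer.Divisibility using (_∣_)
open import Data.Product using (Σ; _×_; ∃)
open import Relation.Binary.PropositionalEquality using (_≡_)

import Data.Nat as ℕ
import Data.Nat.Properties as ℕ
import Data.Nat.Tactic.RingSolver as ℕ-Solver
open import Data.Nat.Divisibility using (∣1⇒≡1)
open import Data.Nat.Induction using (<-wellFounded)
open import Data.Integer using (-_; ∣_∣; _≤_; 0ℤ; -1ℤ; 1ℤ; -[1+_]; +≤+; -≤+)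
import Data.Integer.Base as ℤ using (_⊖_; NonZero; ≢-nonZero)
import Data.Integer.Properties as ℤ
open import Data.Integer.DivMod using (_/ℕ_; _%ℕ_; a≡a%ℕn+[a/ℕn]*n; n%ℕd<d)
import Data.Integer.Divisibility.Signed as Signed
open import Data.Integer.Tactic.RingSolver using (solve; solve-∀)
open import Data.Empty using (⊥; ⊥-elim)
open import Data.List using (_∷_; [])
open import Data.Product using (_,_; proj₁; proj₂; ∃₂)
open import Data.Sum using (_⊎_; inj₁; inj₂)
open import Induction.WellFounded using (Acc; acc)
open import Relation.Nullary using (¬_; yes; no)
open import Relation.Binary.PropositionalEquality
  using (_≢_; refl; sym; trans; cong; cong₂; subst; subst₂; module ≡-Reasoning)

-- mk a b stands for a + bω, where ω² = -1 - ω.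
data ℤ[ω] : Set where
  mk : ℤ → ℤ → ℤ[ω]

infixl 7 _⊗_
infixl 6 _⊕_ _⊖_

_⊕_ _⊖_ _⊗_ : ℤ[ω] → ℤ[ω] → ℤ[ω]
mk a b ⊕ mk c d = mk (a + c) (b + d)
mk a b ⊖ mk c d = mk (a - c) (b - d)
mk a b ⊗ mk c d = mk (a * c - b * d) (a * d + b * c - b * d)

re im : ℤ[ω] → ℤ
re (mk a _) = a
im (mk _ b) = b

ι : ℤ → ℤ[ω]
ι n = mk n (+ 0)

0ω 1ω ω ω² : ℤ[ω]
0ω = ι (+ 0)
1ω = ι 1ℤ
ω  = mk (+ 0) 1ℤ
ω² = mk -1ℤ -1ℤ

conj : ℤ[ω] → ℤ[ω]
conj (mk a b) = mk (a - b) (- b)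

N : ℤ[ω] → ℤ
N (mk a b) = a * a - a * b + b * b

⊗-comm : ∀ x y → x ⊗ y ≡ y ⊗ x
⊗-comm (mk a b) (mk c d) = cong₂ mk (solve (a ∷ b ∷ c ∷ d ∷ [])) (solve (a ∷ b ∷ c ∷ d ∷ []))

⊗-assoc : ∀ x y z → (x ⊗ y) ⊗ z ≡ x ⊗ (y ⊗ z)
⊗-assoc (mk a b) (mk c d) (mk e f) =
  cong₂ mk (solve (a ∷ b ∷ c ∷ d ∷ e ∷ f ∷ [])) (solve (a ∷ b ∷ c ∷ d ∷ e ∷ f ∷ []))

⊗-identityˡ : ∀ x → 1ω ⊗ x ≡ x
⊗-identityˡ (mk a b) = cong₂ mk (solve (a ∷ b ∷ [])) (solve (a ∷ b ∷ []))

⊗-identityʳ : ∀ x → x ⊗ 1ω ≡ x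
⊗-identityʳ x = trans (⊗-comm x 1ω) (⊗-identityˡ x)

⊗-distribʳ-⊖ : ∀ x y z → (x ⊖ y) ⊗ z ≡ x ⊗ z ⊖ y ⊗ z
⊗-distribʳ-⊖ (mk a b) (mk c d) (mk e f) =
  cong₂ mk (solve (a ∷ b ∷ c ∷ d ∷ e ∷ f ∷ [])) (solve (a ∷ b ∷ c ∷ d ∷ e ∷ f ∷ []))

⊗-distribʳ-linear : ∀ s t k l d → (s ⊗ k ⊕ t ⊗ l) ⊗ d ≡ s ⊗ (k ⊗ d) ⊕ t ⊗ (l ⊗ d)
⊗-distribʳ-linear (mk s₁ s₂) (mk t₁ t₂) (mk k₁ k₂) (mk l₁ l₂) (mk d₁ d₂) =
  cong₂ mk (solve (s₁ ∷ s₂ ∷ t₁ ∷ t₂ ∷ k₁ ∷ k₂ ∷ l₁ ∷ l₂ ∷ d₁ ∷ d₂ ∷ []))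
           (solve (s₁ ∷ s₂ ∷ t₁ ∷ t₂ ∷ k₁ ∷ k₂ ∷ l₁ ∷ l₂ ∷ d₁ ∷ d₂ ∷ []))

ι-* : ∀ m n → ι (m * n) ≡ ι m ⊗ ι n
ι-* m n = cong₂ mk (solve (m ∷ n ∷ [])) (solve (m ∷ n ∷ []))

conj-⊗ : ∀ x y → conj (x ⊗ y) ≡ conj x ⊗ conj y
conj-⊗ (mk a b) (mk c d) = cong₂ mk (solve (a ∷ b ∷ c ∷ d ∷ [])) (solve (a ∷ b ∷ c ∷ d ∷ []))

conj-involutive : ∀ x → conj (conj x) ≡ x
conj-involutive (mk a b) = cong₂ mk (solve (a ∷ b ∷ [])) (solve (a ∷ b ∷ []))

-- The integer ring solver treats N as an opaque constant, so identities involving norms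
-- are proved in the coordinates they unfold to.
N-⊗ : ∀ x y → N (x ⊗ y) ≡ N x * N y
N-⊗ (mk a b) (mk c d) = expanded a b c d
  where
  expanded : ∀ a b c d → let u = a * c - b * d; v = a * d + b * c - b * d in
             u * u - u * v + v * v ≡ (a * a - a * b + b * b) * (c * c - c * d + d * d)
  expanded = solve-∀

N-conj : ∀ x → N (conj x) ≡ N x
N-conj (mk a b) = expanded a b
  where
  expanded : ∀ a b → (a - b) * (a - b) - (a - b) * (- b) + (- b) * (- b) ≡ a * a - a * b + b * b
  expanded = solve-∀

⊗-conj : ∀ x → x ⊗ conj x ≡ ι (N x)
⊗-conj (mk a b) = cong₂ mk (expanded a b) (solve (a ∷ b ∷ []))
  where
  expanded : ∀ a b → a * (a - b) - b * (- b) ≡ a * a - a * b + b * b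
  expanded = solve-∀

i*i≡+∣i∣*∣i∣ : ∀ i → i * i ≡ + (∣ i ∣ ℕ.* ∣ i ∣)
i*i≡+∣i∣*∣i∣ (+ n)    = sym (ℤ.pos-* n n)
i*i≡+∣i∣*∣i∣ -[1+ n ] = refl

4N≡squares : ∀ a b → let u = + 2 * a - b in
             + 4 * N (mk a b) ≡ + (∣ u ∣ ℕ.* ∣ u ∣ ℕ.+ 3 ℕ.* (∣ b ∣ ℕ.* ∣ b ∣))
4N≡squares a b = begin
  + 4 * N (mk a b)         ≡⟨ expanded a b ⟩
  u * u + + 3 * (b * b)    ≡⟨ cong₂ (λ s t → s + + 3 * t) (i*i≡+∣i∣*∣i∣ u) (i*i≡+∣i∣*∣i∣ b) ⟩
  + U + + 3 * + V          ≡⟨ cong (_+_ (+ U)) (ℤ.pos-* 3 V) ⟨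
  + U + + (3 ℕ.* V)        ≡⟨ ℤ.pos-+ U (3 ℕ.* V) ⟨
  + (U ℕ.+ 3 ℕ.* V)        ∎
  where
  open ≡-Reasoning
  u = + 2 * a - b
  U = ∣ u ∣ ℕ.* ∣ u ∣
  V = ∣ b ∣ ℕ.* ∣ b ∣
  expanded : ∀ a b → + 4 * (a * a - a * b + b * b) ≡ (+ 2 * a - b) * (+ 2 * a - b) + + 3 * (b * b)
  expanded = solve-∀

0≤N : ∀ x → 0ℤ ≤ N x
0≤N (mk a b) =
  ℤ.*-cancelˡ-≤-pos 0ℤ (N (mk a b)) (+ 4) (subst (0ℤ ≤_) (sym (4N≡squares a b)) (+≤+ ℕ.z≤n))

m*m≡0⇒m≡0 : ∀ m → m ℕ.* m ≡ 0 → m ≡ 0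
m*m≡0⇒m≡0 0         _  = refl
m*m≡0⇒m≡0 (ℕ.suc m) ()

N≡0⇒≡0ω : ∀ x → N x ≡ 0ℤ → x ≡ 0ω
N≡0⇒≡0ω (mk a b) N≡0 = cong₂ mk a≡0 b≡0
  where
  u = + 2 * a - b
  squares≡0 : ∣ u ∣ ℕ.* ∣ u ∣ ℕ.+ 3 ℕ.* (∣ b ∣ ℕ.* ∣ b ∣) ≡ 0
  squares≡0 = ℤ.+-injective (trans (sym (4N≡squares a b)) (cong (+ 4 *_) N≡0))
  b≡0 : b ≡ 0ℤ
  b≡0 = ℤ.∣i∣≡0⇒i≡0 (m*m≡0⇒m≡0 ∣ b ∣
          (ℕ.*-cancelˡ-≡ (∣ b ∣ ℕ.* ∣ b ∣) 0 3 (ℕ.m+n≡0⇒n≡0 (∣ u ∣ ℕ.* ∣ u ∣) squares≡0)))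
  u≡0 : u ≡ 0ℤ
  u≡0 = ℤ.∣i∣≡0⇒i≡0 (m*m≡0⇒m≡0 ∣ u ∣ (ℕ.m+n≡0⇒m≡0 (∣ u ∣ ℕ.* ∣ u ∣) squares≡0))
  2a≡u+b : ∀ a b → + 2 * a ≡ (+ 2 * a - b) + b
  2a≡u+b = solve-∀
  a≡0 : a ≡ 0ℤ
  a≡0 = ℤ.*-cancelˡ-≡ (+ 2) a 0ℤ (trans (2a≡u+b a b) (cong₂ _+_ u≡0 b≡0))

∥_∥ : ℤ[ω] → ℕ
∥ x ∥ = ∣ N x ∣

+∥x∥≡N : ∀ x → + ∥ x ∥ ≡ N x
+∥x∥≡N x = ℤ.0≤i⇒+∣i∣≡i (0≤N x)

∥x∥≡0⇒x≡0ω : ∀ x → ∥ x ∥ ≡ 0 → x ≡ 0ω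
∥x∥≡0⇒x≡0ω x ∥x∥≡0 = N≡0⇒≡0ω x (trans (sym (+∥x∥≡N x)) (cong +_ ∥x∥≡0))

⊗-cancelʳ : ∀ g {x y} → g ≢ 0ω → x ⊗ g ≡ y ⊗ g → x ≡ y
⊗-cancelʳ g {x} {y} g≢0 x⊗g≡y⊗g = begin
  x               ≡⟨ add-sub x y ⟩
  y ⊕ (x ⊖ y)     ≡⟨ cong (y ⊕_) x⊖y≡0 ⟩
  y ⊕ 0ω          ≡⟨ ⊕-identityʳ y ⟩
  y               ∎
  where
  open ≡-Reasoning
  add-sub : ∀ x y → x ≡ y ⊕ (x ⊖ y)
  add-sub (mk a b) (mk c d) = cong₂ mk (solve (a ∷ b ∷ c ∷ d ∷ [])) (solve (a ∷ b ∷ c ∷ d ∷ []))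
  ⊕-identityʳ : ∀ x → x ⊕ 0ω ≡ x
  ⊕-identityʳ (mk a b) = cong₂ mk (ℤ.+-identityʳ a) (ℤ.+-identityʳ b)
  ⊖-self : ∀ x → x ⊖ x ≡ 0ω
  ⊖-self (mk a b) = cong₂ mk (ℤ.+-inverseʳ a) (ℤ.+-inverseʳ b)
  N[x-y]*Ng≡0 : N (x ⊖ y) * N g ≡ 0ℤ
  N[x-y]*Ng≡0 = begin
    N (x ⊖ y) * N g       ≡⟨ N-⊗ (x ⊖ y) g ⟨
    N ((x ⊖ y) ⊗ g)       ≡⟨ cong N (⊗-distribʳ-⊖ x y g) ⟩
    N (x ⊗ g ⊖ y ⊗ g)     ≡⟨ cong (λ w → N (w ⊖ y ⊗ g)) x⊗g≡y⊗g ⟩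
    N (y ⊗ g ⊖ y ⊗ g)     ≡⟨ cong N (⊖-self (y ⊗ g)) ⟩
    0ℤ                    ∎
  x⊖y≡0 : x ⊖ y ≡ 0ω
  x⊖y≡0 with ℤ.i*j≡0⇒i≡0∨j≡0 (N (x ⊖ y)) N[x-y]*Ng≡0
  ... | inj₁ N[x-y]≡0 = N≡0⇒≡0ω (x ⊖ y) N[x-y]≡0
  ... | inj₂ Ng≡0     = ⊥-elim (g≢0 (N≡0⇒≡0ω g Ng≡0))

infix 4 _∣ω_

_∣ω_ : ℤ[ω] → ℤ[ω] → Set
d ∣ω x = ∃ λ c → x ≡ c ⊗ d

∣ω-refl : ∀ d → d ∣ω d
∣ω-refl d = 1ω , sym (⊗-identityˡ d)

∣ω-⊗ˡ : ∀ {d x} c → d ∣ω x → d ∣ω c ⊗ x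
∣ω-⊗ˡ {d} c (k , x≡kd) = c ⊗ k , trans (cong (c ⊗_) x≡kd) (sym (⊗-assoc c k d))

∣ω-linear : ∀ {d u v} s t → d ∣ω u → d ∣ω v → d ∣ω s ⊗ u ⊕ t ⊗ v
∣ω-linear {d} s t (k , u≡kd) (l , v≡ld) =
  s ⊗ k ⊕ t ⊗ l , trans (cong₂ (λ u v → s ⊗ u ⊕ t ⊗ v) u≡kd v≡ld) (sym (⊗-distribʳ-linear s t k l d))

∣ω-norm : ∀ b → b ∣ω ι (N b)
∣ω-norm b = conj b , trans (sym (⊗-conj b)) (⊗-comm b (conj b))

i≤+∣i∣ : ∀ i → i ≤ + ∣ i ∣
i≤+∣i∣ (+ n)    = ℤ.≤-refl
i≤+∣i∣ -[1+ n ] = -≤+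

N≤3n² : ∀ u v n → ∣ u ∣ ℕ.≤ n → ∣ v ∣ ℕ.≤ n → N (mk u v) ≤ + (3 ℕ.* (n ℕ.* n))
N≤3n² u v n ∣u∣≤n ∣v∣≤n = begin
  u * u - u * v + v * v                   ≤⟨ ℤ.+-monoˡ-≤ (v * v) (ℤ.+-monoʳ-≤ (u * u) (i≤+∣i∣ (- (u * v)))) ⟩
  u * u + + ∣ - (u * v) ∣ + v * v         ≡⟨ cong₂ _+_ (cong₂ _+_ (i*i≡+∣i∣*∣i∣ u) ∣-uv∣≡pq) (i*i≡+∣i∣*∣i∣ v) ⟩
  + (p ℕ.* p) + + (p ℕ.* q) + + (q ℕ.* q)  ≡⟨ cong (_+ + (q ℕ.* q)) (ℤ.pos-+ (p ℕ.* p) (p ℕ.* q)) ⟨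
  + (p ℕ.* p ℕ.+ p ℕ.* q) + + (q ℕ.* q)    ≡⟨ ℤ.pos-+ (p ℕ.* p ℕ.+ p ℕ.* q) (q ℕ.* q) ⟨
  + (p ℕ.* p ℕ.+ p ℕ.* q ℕ.+ q ℕ.* q)      ≤⟨ +≤+ (ℕ.+-mono-≤ (ℕ.+-mono-≤ (ℕ.*-mono-≤ ∣u∣≤n ∣u∣≤n)
                                                                      (ℕ.*-mono-≤ ∣u∣≤n ∣v∣≤n))
                                                           (ℕ.*-mono-≤ ∣v∣≤n ∣v∣≤n)) ⟩
  + (n ℕ.* n ℕ.+ n ℕ.* n ℕ.+ n ℕ.* n)      ≡⟨ cong +_ (ℕ-Solver.solve (n ∷ [])) ⟩
  + (3 ℕ.* (n ℕ.* n))                      ∎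
  where
  open ℤ.≤-Reasoning
  p = ∣ u ∣
  q = ∣ v ∣
  ∣-uv∣≡pq : + ∣ - (u * v) ∣ ≡ + (p ℕ.* q)
  ∣-uv∣≡pq = cong +_ (trans (ℤ.∣-i∣≡∣i∣ (u * v)) (ℤ.abs-* u v))

∣t-n∣≤n : ∀ t n → t ℕ.< 2 ℕ.* n → ∣ + t - + n ∣ ℕ.≤ n
∣t-n∣≤n t n t<2n rewrite ℤ.m-n≡m⊖n t n with t ℕ.≤? n
... | yes t≤n = subst (ℕ._≤ n) (sym (ℤ.∣⊖∣-≤ t≤n)) (ℕ.m∸n≤m n t)
... | no  t≰n = subst (ℕ._≤ n) (sym ∣t⊖n∣≡t∸n) t∸n≤n
  where
  ∣t⊖n∣≡t∸n : ∣ t ℤ.⊖ n ∣ ≡ t ℕ.∸ n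
  ∣t⊖n∣≡t∸n = trans (ℤ.∣m⊖n∣≡∣n⊖m∣ t n) (ℤ.∣⊖∣-≤ (ℕ.≰⇒≥ t≰n))
  t∸n≤n : t ℕ.∸ n ℕ.≤ n
  t∸n≤n = subst (t ℕ.∸ n ℕ.≤_) (ℕ.+-identityʳ n) (ℕ.m≤n+o⇒m∸n≤o t n (ℕ.<⇒≤ t<2n))

-- k is i/n rounded to the nearest integer, namely the quotient of 2i + n by 2n.
nearest-multiple : ∀ i n .{{_ : ℕ.NonZero n}} → ∃ λ k → ∣ + 2 * (i - k * + n) ∣ ℕ.≤ n
nearest-multiple i n = k , subst (λ e → ∣ e ∣ ℕ.≤ n) (sym 2[i-kn]≡t-n) (∣t-n∣≤n t n (n%ℕd<d j 2n))
  where
  open ≡-Reasoning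
  2n = 2 ℕ.* n
  instance
    2n≢0 : ℕ.NonZero 2n
    2n≢0 = ℕ.m*n≢0 2 n
  j = + 2 * i + + n
  k = j /ℕ 2n
  t = j %ℕ 2n
  rearranged : ∀ i k m → + 2 * (i - k * m) ≡ (+ 2 * i + m) - k * (+ 2 * m) - m
  rearranged = solve-∀
  cancelled : ∀ t l m → t + l - l - m ≡ t - m
  cancelled = solve-∀
  2[i-kn]≡t-n : + 2 * (i - k * + n) ≡ + t - + n
  2[i-kn]≡t-n = begin
    + 2 * (i - k * + n)                      ≡⟨ rearranged i k (+ n) ⟩
    (+ 2 * i + + n) - k * (+ 2 * + n) - + n  ≡⟨ cong (λ m → j - k * m - + n) (ℤ.pos-* 2 n) ⟨
    j - k * + 2n - + n                       ≡⟨ cong (λ m → m - k * + 2n - + n) (a≡a%ℕn+[a/ℕn]*n j 2n) ⟩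
    + t + k * + 2n - k * + 2n - + n          ≡⟨ cancelled (+ t) (k * + 2n) (+ n) ⟩
    + t - + n                                ∎

nearest-multipleω : ∀ z n .{{_ : ℕ.NonZero n}} → ∃ λ q → + 4 * N (z ⊖ q ⊗ ι (+ n)) ≤ + (3 ℕ.* (n ℕ.* n))
nearest-multipleω (mk z₁ z₂) n =
  let k₁ , 2e₁≤n = nearest-multiple z₁ n
      k₂ , 2e₂≤n = nearest-multiple z₂ n
      e₁ = z₁ - k₁ * + n
      e₂ = z₂ - k₂ * + n
  in  mk k₁ k₂ , (begin
    + 4 * N (mk z₁ z₂ ⊖ mk k₁ k₂ ⊗ ι (+ n))        ≡⟨ N-⊗ (ι (+ 2)) (mk z₁ z₂ ⊖ mk k₁ k₂ ⊗ ι (+ n)) ⟨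
    N (ι (+ 2) ⊗ (mk z₁ z₂ ⊖ mk k₁ k₂ ⊗ ι (+ n)))  ≡⟨ cong N (doubled-remainder z₁ z₂ k₁ k₂ (+ n)) ⟩
    N (mk (+ 2 * e₁) (+ 2 * e₂))                   ≤⟨ N≤3n² (+ 2 * e₁) (+ 2 * e₂) n 2e₁≤n 2e₂≤n ⟩
    + (3 ℕ.* (n ℕ.* n))                            ∎)
  where
  open ℤ.≤-Reasoning
  doubled-remainder : ∀ z₁ z₂ k₁ k₂ m →
    ι (+ 2) ⊗ (mk z₁ z₂ ⊖ mk k₁ k₂ ⊗ ι m) ≡ mk (+ 2 * (z₁ - k₁ * m)) (+ 2 * (z₂ - k₂ * m))
  doubled-remainder z₁ z₂ k₁ k₂ m =
    cong₂ mk (solve (z₁ ∷ z₂ ∷ k₁ ∷ k₂ ∷ m ∷ [])) (solve (z₁ ∷ z₂ ∷ k₁ ∷ k₂ ∷ m ∷ []))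

-- Multiplying by conj b turns division by b into division by the integer N b.
euclidean-division : ∀ a b → ∥ b ∥ ≢ 0 → ∃ λ q → ∥ a ⊖ q ⊗ b ∥ ℕ.< ∥ b ∥
euclidean-division a b ∥b∥≢0 = q , ∥r∥<n
  where
  open ℤ.≤-Reasoning
  n = ∥ b ∥
  instance
    n≢0 : ℕ.NonZero n
    n≢0 = ℕ.≢-nonZero ∥b∥≢0
  Q = nearest-multipleω (a ⊗ conj b) n
  q = proj₁ Q
  r = a ⊖ q ⊗ b
  b⊗conj-b≡n : b ⊗ conj b ≡ ι (+ n)
  b⊗conj-b≡n = trans (⊗-conj b) (cong ι (sym (+∥x∥≡N b)))
  r⊗conj-b≡ : r ⊗ conj b ≡ a ⊗ conj b ⊖ q ⊗ ι (+ n)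
  r⊗conj-b≡ = trans (⊗-distribʳ-⊖ a (q ⊗ b) (conj b))
    (cong (a ⊗ conj b ⊖_) (trans (⊗-assoc q b (conj b)) (cong (q ⊗_) b⊗conj-b≡n)))
  4∥r∥n≤3n² : + (4 ℕ.* (∥ r ∥ ℕ.* n)) ≤ + (3 ℕ.* (n ℕ.* n))
  4∥r∥n≤3n² = begin
    + (4 ℕ.* (∥ r ∥ ℕ.* n))              ≡⟨ trans (ℤ.pos-* 4 (∥ r ∥ ℕ.* n)) (cong (+ 4 *_) (ℤ.pos-* ∥ r ∥ n)) ⟩
    + 4 * (+ ∥ r ∥ * + n)                ≡⟨ cong₂ (λ s t → + 4 * (s * t)) (+∥x∥≡N r) (+∥x∥≡N b) ⟩
    + 4 * (N r * N b)                    ≡⟨ cong (λ t → + 4 * (N r * t)) (N-conj b) ⟨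
    + 4 * (N r * N (conj b))             ≡⟨ cong (+ 4 *_) (N-⊗ r (conj b)) ⟨
    + 4 * N (r ⊗ conj b)                 ≡⟨ cong (λ w → + 4 * N w) r⊗conj-b≡ ⟩
    + 4 * N (a ⊗ conj b ⊖ q ⊗ ι (+ n))   ≤⟨ proj₂ Q ⟩
    + (3 ℕ.* (n ℕ.* n))                  ∎
  ∥r∥<n : ∥ r ∥ ℕ.< n
  ∥r∥<n = ℕ.*-cancelʳ-< n ∥ r ∥ n (ℕ.*-cancelˡ-< 4 (∥ r ∥ ℕ.* n) (n ℕ.* n)
            (ℕ.≤-<-trans (ℤ.drop‿+≤+ 4∥r∥n≤3n²) (ℕ.*-monoˡ-< (n ℕ.* n) {{ℕ.m*n≢0 n n}} (ℕ.n<1+n 3))))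

record Bézout (a b : ℤ[ω]) : Set where
  field
    gcd      : ℤ[ω]
    gcd∣a    : gcd ∣ω a
    gcd∣b    : gcd ∣ω b
    x y      : ℤ[ω]
    identity : gcd ≡ x ⊗ a ⊕ y ⊗ b

bézout-zero : ∀ a → Bézout a 0ω
bézout-zero a = record
  { gcd = a ; gcd∣a = ∣ω-refl a ; gcd∣b = 0ω , sym (⊗-zeroˡ a)
  ; x = 1ω ; y = 0ω ; identity = a≡1a+00 a
  }
  where
  ⊗-zeroˡ : ∀ x → 0ω ⊗ x ≡ 0ω
  ⊗-zeroˡ (mk a b) = cong₂ mk (solve (a ∷ b ∷ [])) (solve (a ∷ b ∷ []))
  a≡1a+00 : ∀ a → a ≡ 1ω ⊗ a ⊕ 0ω ⊗ 0ω
  a≡1a+00 (mk a b) = cong₂ mk (solve (a ∷ b ∷ [])) (solve (a ∷ b ∷ []))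

bézout-step : ∀ a b q → Bézout b (a ⊖ q ⊗ b) → Bézout a b
bézout-step a b q B = record
  { gcd = gcd ; gcd∣a = subst (gcd ∣ω_) (sym (a≡qb+r a b q)) (∣ω-linear q 1ω gcd∣a gcd∣b) ; gcd∣b = gcd∣a
  ; x = y ; y = x ⊖ y ⊗ q ; identity = trans identity (rearranged a b q x y)
  }
  where
  open Bézout B
  a≡qb+r : ∀ a b q → a ≡ q ⊗ b ⊕ 1ω ⊗ (a ⊖ q ⊗ b)
  a≡qb+r (mk a₁ a₂) (mk b₁ b₂) (mk q₁ q₂) =
    cong₂ mk (solve (a₁ ∷ a₂ ∷ b₁ ∷ b₂ ∷ q₁ ∷ q₂ ∷ [])) (solve (a₁ ∷ a₂ ∷ b₁ ∷ b₂ ∷ q₁ ∷ q₂ ∷ []))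
  rearranged : ∀ a b q x y → x ⊗ b ⊕ y ⊗ (a ⊖ q ⊗ b) ≡ y ⊗ a ⊕ (x ⊖ y ⊗ q) ⊗ b
  rearranged (mk a₁ a₂) (mk b₁ b₂) (mk q₁ q₂) (mk x₁ x₂) (mk y₁ y₂) =
    cong₂ mk (solve (a₁ ∷ a₂ ∷ b₁ ∷ b₂ ∷ q₁ ∷ q₂ ∷ x₁ ∷ x₂ ∷ y₁ ∷ y₂ ∷ []))
             (solve (a₁ ∷ a₂ ∷ b₁ ∷ b₂ ∷ q₁ ∷ q₂ ∷ x₁ ∷ x₂ ∷ y₁ ∷ y₂ ∷ []))

euclid : ∀ a b → Acc ℕ._<_ ∥ b ∥ → Bézout a b
euclid a b (acc rec) with ∥ b ∥ ℕ.≟ 0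
... | yes ∥b∥≡0 = subst (Bézout a) (sym (∥x∥≡0⇒x≡0ω b ∥b∥≡0)) (bézout-zero a)
... | no  ∥b∥≢0 with euclidean-division a b ∥b∥≢0
...   | q , ∥r∥<∥b∥ = bézout-step a b q (euclid b (a ⊖ q ⊗ b) (rec ∥r∥<∥b∥))

bézout : ∀ a b → Bézout a b
bézout a b = euclid a b (<-wellFounded ∥ b ∥)

parity : ∀ i → ∃ λ h → i ≡ h * + 2 ⊎ i ≡ 1ℤ + h * + 2
parity i with i %ℕ 2 | n%ℕd<d i 2 | a≡a%ℕn+[a/ℕn]*n i 2
... | 0                 | _                  | i≡0+2h = i /ℕ 2 , inj₁ (trans i≡0+2h (ℤ.+-identityˡ _))
... | 1                 | _                  | i≡1+2h = i /ℕ 2 , inj₂ i≡1+2h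
... | ℕ.suc (ℕ.suc _) | ℕ.s≤s (ℕ.s≤s ()) | _

2∤1+2t : ∀ t → ¬ + 2 Signed.∣ 1ℤ + t * + 2
2∤1+2t t 2∣1+2t
  with ∣1⇒≡1 (Signed.∣⇒∣ᵤ (Signed.∣m+n∣n⇒∣m {m = 1ℤ} {n = t * + 2} 2∣1+2t (Signed.divides t refl)))
... | ()

divmod-2 : ∀ x → ∃ λ z → ∃₂ λ r s → x ≡ ι (+ 2) ⊗ z ⊕ mk (+ r) (+ s) × r ℕ.< 2 × s ℕ.< 2
divmod-2 (mk a b) =
  mk (a /ℕ 2) (b /ℕ 2) , a %ℕ 2 , b %ℕ 2 ,
  trans (cong₂ mk (a≡a%ℕn+[a/ℕn]*n a 2) (a≡a%ℕn+[a/ℕn]*n b 2))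
        (regroup (+ (a %ℕ 2)) (+ (b %ℕ 2)) (a /ℕ 2) (b /ℕ 2)) ,
  n%ℕd<d a 2 , n%ℕd<d b 2
  where
  regroup : ∀ r s h k → mk (r + h * + 2) (s + k * + 2) ≡ ι (+ 2) ⊗ mk h k ⊕ mk r s
  regroup r s h k = cong₂ mk (solve (r ∷ s ∷ h ∷ k ∷ [])) (solve (r ∷ s ∷ h ∷ k ∷ []))

Unit : ℤ[ω] → Set
Unit u = ∃ λ v → u ⊗ v ≡ 1ω

N-unit : ∀ {u} → Unit u → N u ≡ 1ℤ
N-unit {u} (v , u⊗v≡1) = trans (sym (+∥x∥≡N u)) (cong +_ (ℕ.m*n≡1⇒m≡1 ∥ u ∥ ∥ v ∥ ∥u∥*∥v∥≡1))
  where
  ∥u∥*∥v∥≡1 : ∥ u ∥ ℕ.* ∥ v ∥ ≡ 1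
  ∥u∥*∥v∥≡1 = trans (sym (ℤ.abs-* (N u) (N v))) (cong ∣_∣ (trans (sym (N-⊗ u v)) (cong N u⊗v≡1)))

⊗-inverse-mod-2 : ∀ {x z ρ} u → x ≡ ι (+ 2) ⊗ z ⊕ ρ → ρ ⊗ u ≡ 1ω → x ⊗ u ≡ ι (+ 2) ⊗ (z ⊗ u) ⊕ 1ω
⊗-inverse-mod-2 {x} {z} {ρ} u x≡2z+ρ ρ⊗u≡1 = begin
  x ⊗ u                      ≡⟨ cong (_⊗ u) x≡2z+ρ ⟩
  (ι (+ 2) ⊗ z ⊕ ρ) ⊗ u      ≡⟨ distributed z ρ u ⟩
  ι (+ 2) ⊗ (z ⊗ u) ⊕ ρ ⊗ u  ≡⟨ cong (ι (+ 2) ⊗ (z ⊗ u) ⊕_) ρ⊗u≡1 ⟩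
  ι (+ 2) ⊗ (z ⊗ u) ⊕ 1ω     ∎
  where
  open ≡-Reasoning
  distributed : ∀ z ρ u → (ι (+ 2) ⊗ z ⊕ ρ) ⊗ u ≡ ι (+ 2) ⊗ (z ⊗ u) ⊕ ρ ⊗ u
  distributed (mk z₁ z₂) (mk r s) (mk u₁ u₂) =
    cong₂ mk (solve (z₁ ∷ z₂ ∷ r ∷ s ∷ u₁ ∷ u₂ ∷ [])) (solve (z₁ ∷ z₂ ∷ r ∷ s ∷ u₁ ∷ u₂ ∷ []))

-- ℤ[ω]/2 is the field with four elements: every nonzero residue 1, ω, 1 + ω is a unit.
mod-2 : ∀ x → ι (+ 2) ∣ω x ⊎ ∃₂ λ u w → Unit u × x ⊗ u ≡ ι (+ 2) ⊗ w ⊕ 1ω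
mod-2 x with divmod-2 x
... | z , 0 , 0 , x≡2z , _ , _ = inj₁ (z , trans x≡2z (2z+0≡z⊗2 z))
  where
  2z+0≡z⊗2 : ∀ z → ι (+ 2) ⊗ z ⊕ 0ω ≡ z ⊗ ι (+ 2)
  2z+0≡z⊗2 (mk a b) = cong₂ mk (solve (a ∷ b ∷ [])) (solve (a ∷ b ∷ []))
... | z , 1 , 0 , x≡2z+1 , _ , _ =
  inj₂ (1ω , z ⊗ 1ω , (1ω , refl) , ⊗-inverse-mod-2 1ω x≡2z+1 refl)
... | z , 0 , 1 , x≡2z+ω , _ , _ =
  inj₂ (ω² , z ⊗ ω² , (ω , refl) , ⊗-inverse-mod-2 ω² x≡2z+ω refl)
... | z , 1 , 1 , x≡2z+1+ω , _ , _ =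
  inj₂ (mk (+ 0) -1ℤ , z ⊗ mk (+ 0) -1ℤ , (mk 1ℤ 1ℤ , refl) , ⊗-inverse-mod-2 (mk (+ 0) -1ℤ) x≡2z+1+ω refl)
... | _ , ℕ.suc (ℕ.suc _) , _ , _ , ℕ.s≤s (ℕ.s≤s ()) , _
... | _ , _ , ℕ.suc (ℕ.suc _) , _ , _ , ℕ.s≤s (ℕ.s≤s ())

N-2w+1 : ∀ w → ∃ λ t → N (ι (+ 2) ⊗ w ⊕ 1ω) ≡ 1ℤ + t * + 2
N-2w+1 (mk h k) = + 2 * (h * h - h * k + k * k) + + 2 * h - k , trans (cong N (components h k)) (expanded h k)
  where
  components : ∀ h k → ι (+ 2) ⊗ mk h k ⊕ 1ω ≡ mk (1ℤ + h * + 2) (k * + 2)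
  components h k = cong₂ mk (solve (h ∷ k ∷ [])) (solve (h ∷ k ∷ []))
  expanded : ∀ h k → let a = 1ℤ + h * + 2; b = k * + 2 in
             a * a - a * b + b * b ≡ 1ℤ + (+ 2 * (h * h - h * k + k * k) + + 2 * h - k) * + 2
  expanded = solve-∀

2∣N⇒2∣ : ∀ x → + 2 Signed.∣ N x → ι (+ 2) ∣ω x
2∣N⇒2∣ x 2∣Nx with mod-2 x
... | inj₁ 2∣x = 2∣x
... | inj₂ (u , w , u-unit , x⊗u≡2w+1) = ⊥-elim (2∤1+2t t (subst (+ 2 Signed.∣_) Nx≡1+2t 2∣Nx))
  where
  open ≡-Reasoning
  t = proj₁ (N-2w+1 w)
  Nx≡1+2t : N x ≡ 1ℤ + t * + 2
  Nx≡1+2t = begin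
    N x                    ≡⟨ ℤ.*-identityʳ (N x) ⟨
    N x * 1ℤ               ≡⟨ cong (N x *_) (N-unit u-unit) ⟨
    N x * N u              ≡⟨ N-⊗ x u ⟨
    N (x ⊗ u)              ≡⟨ cong N x⊗u≡2w+1 ⟩
    N (ι (+ 2) ⊗ w ⊕ 1ω)   ≡⟨ proj₂ (N-2w+1 w) ⟩
    1ℤ + t * + 2           ∎

Coprime : ℤ[ω] → ℤ[ω] → Set
Coprime a b = ∃₂ λ x y → x ⊗ a ⊕ y ⊗ b ≡ 1ω

coprime-∣⊗ : ∀ {a b c} → Coprime a b → b ∣ω a ⊗ c → b ∣ω c
coprime-∣⊗ {a} {b} {c} (x , y , xa+yb≡1) b∣ac = subst (b ∣ω_) c≡ (∣ω-linear x (c ⊗ y) b∣ac (∣ω-refl b))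
  where
  open ≡-Reasoning
  expanded : ∀ x y a b c → c ⊗ (x ⊗ a ⊕ y ⊗ b) ≡ x ⊗ (a ⊗ c) ⊕ (c ⊗ y) ⊗ b
  expanded (mk x₁ x₂) (mk y₁ y₂) (mk a₁ a₂) (mk b₁ b₂) (mk c₁ c₂) =
    cong₂ mk (solve (x₁ ∷ x₂ ∷ y₁ ∷ y₂ ∷ a₁ ∷ a₂ ∷ b₁ ∷ b₂ ∷ c₁ ∷ c₂ ∷ []))
             (solve (x₁ ∷ x₂ ∷ y₁ ∷ y₂ ∷ a₁ ∷ a₂ ∷ b₁ ∷ b₂ ∷ c₁ ∷ c₂ ∷ []))
  c≡ : x ⊗ (a ⊗ c) ⊕ (c ⊗ y) ⊗ b ≡ c
  c≡ = begin
    x ⊗ (a ⊗ c) ⊕ (c ⊗ y) ⊗ b  ≡⟨ expanded x y a b c ⟨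
    c ⊗ (x ⊗ a ⊕ y ⊗ b)        ≡⟨ cong (c ⊗_) xa+yb≡1 ⟩
    c ⊗ 1ω                     ≡⟨ ⊗-identityʳ c ⟩
    c                          ∎

coprime⇒¬2∣both : ∀ {a b} → Coprime a b → ι (+ 2) ∣ω a → ι (+ 2) ∣ω b → ⊥
coprime⇒¬2∣both (x , y , xa+yb≡1) 2∣a 2∣b with subst (ι (+ 2) ∣ω_) xa+yb≡1 (∣ω-linear x y 2∣a 2∣b)
... | c , 1≡c⊗2 = 2∤1+2t 0ℤ (Signed.divides (N c * + 2) 1≡Nc*2*2)
  where
  1≡Nc*2*2 : 1ℤ ≡ N c * + 2 * + 2
  1≡Nc*2*2 = trans (cong N 1≡c⊗2) (trans (N-⊗ c (ι (+ 2))) (sym (ℤ.*-assoc (N c) (+ 2) (+ 2))))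

∣2⊗c⇒∣c : ∀ {b c} t → N b ≡ 1ℤ + t * + 2 → b ∣ω ι (+ 2) ⊗ c → b ∣ω c
∣2⊗c⇒∣c {b} {c} t Nb≡1+2t b∣2c = subst (b ∣ω_) c≡ (∣ω-linear c (ι (- t)) (∣ω-norm b) b∣2c)
  where
  combination : ∀ t c → c ⊗ ι (1ℤ + t * + 2) ⊕ ι (- t) ⊗ (ι (+ 2) ⊗ c) ≡ c
  combination t (mk c₁ c₂) = cong₂ mk (solve (t ∷ c₁ ∷ c₂ ∷ [])) (solve (t ∷ c₁ ∷ c₂ ∷ []))
  c≡ : c ⊗ ι (N b) ⊕ ι (- t) ⊗ (ι (+ 2) ⊗ c) ≡ c
  c≡ = trans (cong (λ n → c ⊗ ι n ⊕ ι (- t) ⊗ (ι (+ 2) ⊗ c)) Nb≡1+2t) (combination t c)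

-- b divides a ⊗ 2 conj a = 2 N a, hence 2 conj a; if N b is odd the factor 2 can be dropped,
-- and if N b is even then 2 divides b and, through N a, also a.
coprime-∣conj : ∀ {a b} → Coprime a b → N b Signed.∣ + 2 * N a → b ∣ω conj a
coprime-∣conj {a} {b} coprime (Signed.divides k 2Na≡kNb) with parity (N b)
... | t , inj₂ Nb≡1+2t = ∣2⊗c⇒∣c t Nb≡1+2t (coprime-∣⊗ coprime b∣a⊗2conj-a)
  where
  open ≡-Reasoning
  a⊗2conj-a≡ : a ⊗ (ι (+ 2) ⊗ conj a) ≡ ι k ⊗ ι (N b)
  a⊗2conj-a≡ = begin
    a ⊗ (ι (+ 2) ⊗ conj a)   ≡⟨ ⊗-assoc a (ι (+ 2)) (conj a) ⟨
    (a ⊗ ι (+ 2)) ⊗ conj a   ≡⟨ cong (_⊗ conj a) (⊗-comm a (ι (+ 2))) ⟩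
    (ι (+ 2) ⊗ a) ⊗ conj a   ≡⟨ ⊗-assoc (ι (+ 2)) a (conj a) ⟩
    ι (+ 2) ⊗ (a ⊗ conj a)   ≡⟨ cong (ι (+ 2) ⊗_) (⊗-conj a) ⟩
    ι (+ 2) ⊗ ι (N a)        ≡⟨ ι-* (+ 2) (N a) ⟨
    ι (+ 2 * N a)            ≡⟨ cong ι 2Na≡kNb ⟩
    ι (k * N b)              ≡⟨ ι-* k (N b) ⟩
    ι k ⊗ ι (N b)            ∎
  b∣a⊗2conj-a : b ∣ω a ⊗ (ι (+ 2) ⊗ conj a)
  b∣a⊗2conj-a = subst (b ∣ω_) (sym a⊗2conj-a≡) (∣ω-⊗ˡ (ι k) (∣ω-norm b))
... | t , inj₁ Nb≡2t = ⊥-elim (coprime⇒¬2∣both coprime 2∣a 2∣b)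
  where
  open ≡-Reasoning
  2∣b : ι (+ 2) ∣ω b
  2∣b = 2∣N⇒2∣ b (Signed.divides t Nb≡2t)
  b′ = proj₁ 2∣b
  regroup : ∀ k n → k * (n * + 4) ≡ + 2 * (k * n * + 2)
  regroup = solve-∀
  2Na≡2[kNb′*2] : + 2 * N a ≡ + 2 * (k * N b′ * + 2)
  2Na≡2[kNb′*2] = begin
    + 2 * N a                ≡⟨ 2Na≡kNb ⟩
    k * N b                  ≡⟨ cong (λ e → k * N e) (proj₂ 2∣b) ⟩
    k * N (b′ ⊗ ι (+ 2))     ≡⟨ cong (k *_) (N-⊗ b′ (ι (+ 2))) ⟩
    k * (N b′ * + 4)         ≡⟨ regroup k (N b′) ⟩
    + 2 * (k * N b′ * + 2)   ∎
  2∣a : ι (+ 2) ∣ω a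
  2∣a = 2∣N⇒2∣ a (Signed.divides (k * N b′) (ℤ.*-cancelˡ-≡ (+ 2) (N a) (k * N b′ * + 2) 2Na≡2[kNb′*2]))

divisor-of-norm : ∀ α β → β ≢ 0ω → N β Signed.∣ + 2 * N α → ∃₂ λ γ δ → α ≡ γ ⊗ δ × N δ ≡ N β
divisor-of-norm α β β≢0 Nβ∣2Nα = conj v , conj b ⊗ g , α≡conj-v⊗δ , Nδ≡Nβ
  where
  open ≡-Reasoning
  open Bézout (bézout α β) renaming (gcd to g)
  a = proj₁ gcd∣a
  b = proj₁ gcd∣b
  α≡a⊗g = proj₂ gcd∣a
  β≡b⊗g = proj₂ gcd∣b
  ⊗-zeroʳ : ∀ x → x ⊗ 0ω ≡ 0ω
  ⊗-zeroʳ (mk a b) = cong₂ mk (solve (a ∷ b ∷ [])) (solve (a ∷ b ∷ []))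
  g≢0 : g ≢ 0ω
  g≢0 g≡0 = β≢0 (trans β≡b⊗g (trans (cong (b ⊗_) g≡0) (⊗-zeroʳ b)))
  coprime : Coprime a b
  coprime = x , y , ⊗-cancelʳ g g≢0 (begin
    (x ⊗ a ⊕ y ⊗ b) ⊗ g        ≡⟨ ⊗-distribʳ-linear x y a b g ⟩
    x ⊗ (a ⊗ g) ⊕ y ⊗ (b ⊗ g)  ≡⟨ cong₂ (λ u v → x ⊗ u ⊕ y ⊗ v) α≡a⊗g β≡b⊗g ⟨
    x ⊗ α ⊕ y ⊗ β              ≡⟨ identity ⟨
    g                          ≡⟨ ⊗-identityˡ g ⟨
    1ω ⊗ g                     ∎)
  instance
    Ng≢0 : ℤ.NonZero (N g)
    Ng≢0 = ℤ.≢-nonZero (λ Ng≡0 → g≢0 (N≡0⇒≡0ω g Ng≡0))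
  Nβ≡Nb*Ng : N β ≡ N b * N g
  Nβ≡Nb*Ng = trans (cong N β≡b⊗g) (N-⊗ b g)
  2Nα≡2Na*Ng : + 2 * N α ≡ + 2 * N a * N g
  2Nα≡2Na*Ng = trans (cong (λ e → + 2 * N e) α≡a⊗g)
                     (trans (cong (+ 2 *_) (N-⊗ a g)) (sym (ℤ.*-assoc (+ 2) (N a) (N g))))
  b∣conj-a : b ∣ω conj a
  b∣conj-a = coprime-∣conj coprime (Signed.*-cancelʳ-∣ (N g) (subst₂ Signed._∣_ Nβ≡Nb*Ng 2Nα≡2Na*Ng Nβ∣2Nα))
  v = proj₁ b∣conj-a
  α≡conj-v⊗δ : α ≡ conj v ⊗ (conj b ⊗ g)
  α≡conj-v⊗δ = begin
    α                          ≡⟨ α≡a⊗g ⟩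
    a ⊗ g                      ≡⟨ cong (_⊗ g) (conj-involutive a) ⟨
    conj (conj a) ⊗ g          ≡⟨ cong (λ e → conj e ⊗ g) (proj₂ b∣conj-a) ⟩
    conj (v ⊗ b) ⊗ g           ≡⟨ cong (_⊗ g) (conj-⊗ v b) ⟩
    (conj v ⊗ conj b) ⊗ g      ≡⟨ ⊗-assoc (conj v) (conj b) g ⟩
    conj v ⊗ (conj b ⊗ g)      ∎
  Nδ≡Nβ : N (conj b ⊗ g) ≡ N β
  Nδ≡Nβ = trans (N-⊗ (conj b) g) (trans (cong (_* N g) (N-conj b)) (sym Nβ≡Nb*Ng))

-- a + b√-3, where √-3 = 1 + 2ω.
_+_√-3 : ℤ → ℤ → ℤ[ω]
a + b √-3 = mk (a + b) (+ 2 * b)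

infix 4 _∈ℤ[√-3]

_∈ℤ[√-3] : ℤ[ω] → Set
x ∈ℤ[√-3] = ∃₂ λ a b → x ≡ a + b √-3

√-3-injective : ∀ {a b c d} → a + b √-3 ≡ c + d √-3 → a ≡ c × b ≡ d
√-3-injective {a} {b} {c} {d} eq = a≡c , b≡d
  where
  open ≡-Reasoning
  b≡d : b ≡ d
  b≡d = ℤ.*-cancelˡ-≡ (+ 2) b d (cong im eq)
  add-sub : ∀ a b → a ≡ a + b - b
  add-sub = solve-∀
  a≡c : a ≡ c
  a≡c = begin
    a          ≡⟨ add-sub a b ⟩
    a + b - b  ≡⟨ cong₂ _-_ (cong re eq) b≡d ⟩
    c + d - d  ≡⟨ add-sub c d ⟨
    c          ∎

conj-√-3 : ∀ a b → conj (a + b √-3) ≡ a + (- b) √-3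
conj-√-3 a b = cong₂ mk (solve (a ∷ b ∷ [])) (solve (a ∷ b ∷ []))

N-√-3 : ∀ a b → N (a + b √-3) ≡ a * a + + 3 * (b * b)
N-√-3 = expanded
  where
  expanded : ∀ a b → (a + b) * (a + b) - (a + b) * (+ 2 * b) + (+ 2 * b) * (+ 2 * b) ≡ a * a + + 3 * (b * b)
  expanded = solve-∀

2∣⇒∈ℤ[√-3] : ∀ {x} → ι (+ 2) ∣ω x → x ∈ℤ[√-3]
2∣⇒∈ℤ[√-3] (mk h k , x≡) = + 2 * h - k , k , trans x≡ (cong₂ mk (solve (h ∷ k ∷ [])) (solve (h ∷ k ∷ [])))

2w+1∈ℤ[√-3] : ∀ w → ι (+ 2) ⊗ w ⊕ 1ω ∈ℤ[√-3]
2w+1∈ℤ[√-3] (mk h k) = + 2 * h - k + 1ℤ , k , cong₂ mk (solve (h ∷ k ∷ [])) (solve (h ∷ k ∷ []))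

shift-unit-into-ℤ[√-3] : ∀ c d → ∃₂ λ c′ d′ → c ⊗ d ≡ c′ ⊗ d′ × N d′ ≡ N d × c′ ∈ℤ[√-3]
shift-unit-into-ℤ[√-3] c d with mod-2 c
... | inj₁ 2∣c = c , d , refl , refl , 2∣⇒∈ℤ[√-3] 2∣c
... | inj₂ (u , w , (v , u⊗v≡1) , c⊗u≡2w+1) =
  c ⊗ u , v ⊗ d , regroup , Nv⊗d≡Nd , subst _∈ℤ[√-3] (sym c⊗u≡2w+1) (2w+1∈ℤ[√-3] w)
  where
  open ≡-Reasoning
  regroup : c ⊗ d ≡ (c ⊗ u) ⊗ (v ⊗ d)
  regroup = begin
    c ⊗ d              ≡⟨ cong (c ⊗_) (⊗-identityˡ d) ⟨
    c ⊗ (1ω ⊗ d)       ≡⟨ cong (λ e → c ⊗ (e ⊗ d)) u⊗v≡1 ⟨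
    c ⊗ ((u ⊗ v) ⊗ d)  ≡⟨ cong (c ⊗_) (⊗-assoc u v d) ⟩
    c ⊗ (u ⊗ (v ⊗ d))  ≡⟨ ⊗-assoc c u (v ⊗ d) ⟨
    (c ⊗ u) ⊗ (v ⊗ d)  ∎
  Nv⊗d≡Nd : N (v ⊗ d) ≡ N d
  Nv⊗d≡Nd = begin
    N (v ⊗ d)   ≡⟨ N-⊗ v d ⟩
    N v * N d   ≡⟨ cong (_* N d) (N-unit (u , trans (⊗-comm v u) u⊗v≡1)) ⟩
    1ℤ * N d    ≡⟨ ℤ.*-identityˡ (N d) ⟩
    N d         ∎

ℤ[√-3]-factorisation : ∀ α β → β ≢ 0ω → N β Signed.∣ + 2 * N α → + 2 Signed.∣ N β →
                       ∃₂ λ γ δ → α ≡ γ ⊗ δ × N δ ≡ N β × γ ∈ℤ[√-3] × δ ∈ℤ[√-3]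
ℤ[√-3]-factorisation α β β≢0 Nβ∣2Nα 2∣Nβ =
  let γ , δ , α≡γ⊗δ , Nδ≡Nβ             = divisor-of-norm α β β≢0 Nβ∣2Nα
      γ′ , δ′ , γ⊗δ≡γ′⊗δ′ , Nδ′≡Nδ , γ′∈ = shift-unit-into-ℤ[√-3] γ δ
      Nδ′≡Nβ                             = trans Nδ′≡Nδ Nδ≡Nβ
  in  γ′ , δ′ , trans α≡γ⊗δ γ⊗δ≡γ′⊗δ′ , Nδ′≡Nβ , γ′∈ ,
      2∣⇒∈ℤ[√-3] (2∣N⇒2∣ δ′ (subst (+ 2 Signed.∣_) (sym Nδ′≡Nβ) 2∣Nβ))

ℤ[√-3]-factor⇒congruences : ∀ {A B γ δ m} → A + B √-3 ≡ γ ⊗ δ → N δ ≡ m → γ ∈ℤ[√-3] → δ ∈ℤ[√-3] →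
  ∃ λ r → ∃ λ s → (m ≡ s * s + + 3 * (r * r)) × (m ∣ A * r + B * s) × (m ∣ A * s - + 3 * B * r)
ℤ[√-3]-factor⇒congruences {A} {B} {γ} {δ} {m} α≡γ⊗δ Nδ≡m (c , d , γ≡) (s , t , δ≡) =
  r , s , m≡s²+3r² ,
  Signed.∣⇒∣ᵤ (Signed.divides d (proj₂ coordinates)) , Signed.∣⇒∣ᵤ (Signed.divides c (proj₁ coordinates))
  where
  open ≡-Reasoning
  r = - t
  conj-δ≡ : conj δ ≡ s + r √-3
  conj-δ≡ = trans (cong conj δ≡) (conj-√-3 s t)
  m≡s²+3r² : m ≡ s * s + + 3 * (r * r)
  m≡s²+3r² = trans (sym Nδ≡m) (trans (sym (N-conj δ)) (trans (cong N conj-δ≡) (N-√-3 s r)))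
  multiply : ∀ A B s r → (A + B √-3) ⊗ (s + r √-3) ≡ (A * s - + 3 * B * r) + (A * r + B * s) √-3
  multiply A B s r = cong₂ mk (solve (A ∷ B ∷ s ∷ r ∷ [])) (solve (A ∷ B ∷ s ∷ r ∷ []))
  scale : ∀ c d m → (c + d √-3) ⊗ ι m ≡ (c * m) + (d * m) √-3
  scale c d m = cong₂ mk (solve (c ∷ d ∷ m ∷ [])) (solve (c ∷ d ∷ m ∷ []))
  coordinates : A * s - + 3 * B * r ≡ c * m × A * r + B * s ≡ d * m
  coordinates = √-3-injective (begin
    (A * s - + 3 * B * r) + (A * r + B * s) √-3  ≡⟨ multiply A B s r ⟨
    (A + B √-3) ⊗ (s + r √-3)                    ≡⟨ cong₂ _⊗_ α≡γ⊗δ (sym conj-δ≡) ⟩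
    (γ ⊗ δ) ⊗ conj δ                             ≡⟨ ⊗-assoc γ δ (conj δ) ⟩
    γ ⊗ (δ ⊗ conj δ)                             ≡⟨ cong (γ ⊗_) (⊗-conj δ) ⟩
    γ ⊗ ι (N δ)                                  ≡⟨ cong₂ (λ e n → e ⊗ ι n) γ≡ Nδ≡m ⟩
    (c + d √-3) ⊗ ι m                            ≡⟨ scale c d m ⟩
    (c * m) + (d * m) √-3                        ∎)

lemma6p2 : (q : ℤ) → q > + 0 →
    (∃ λ r′ → ∃ λ s′ → + 2 * q ≡ s′ * s′ + + 3 * (r′ * r′)) →
    (A B : ℤ) → q ∣ (A * A + + 3 * (B * B)) →
    ∃ λ r → ∃ λ s → (+ 2 * q ≡ s * s + + 3 * (r * r))
    × ((+ 2 * q) ∣ (A * r + B * s))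
    × ((+ 2 * q) ∣ (A * s - + 3 * B * r))
lemma6p2 q q>0 (r′ , s′ , 2q≡s′²+3r′²) A B q∣A²+3B² =
  let γ , δ , α≡γ⊗δ , Nδ≡Nβ , γ∈ , δ∈ = ℤ[√-3]-factorisation (A + B √-3) β β≢0 Nβ∣2Nα 2∣Nβ
  in  ℤ[√-3]-factor⇒congruences {A} {B} α≡γ⊗δ (trans Nδ≡Nβ Nβ≡2q) γ∈ δ∈
  where
  β = s′ + r′ √-3
  Nβ≡2q : N β ≡ + 2 * q
  Nβ≡2q = trans (N-√-3 s′ r′) (sym 2q≡s′²+3r′²)
  β≢0 : β ≢ 0ω
  β≢0 β≡0 = ℤ.<-irrefl (sym (ℤ.*-cancelˡ-≡ (+ 2) q 0ℤ (trans (sym Nβ≡2q) (cong N β≡0)))) q>0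
  Nβ∣2Nα : N β Signed.∣ + 2 * N (A + B √-3)
  Nβ∣2Nα = subst₂ Signed._∣_ (sym Nβ≡2q) (cong (+ 2 *_) (sym (N-√-3 A B)))
             (Signed.*-monoʳ-∣ (+ 2) (Signed.∣ᵤ⇒∣ q∣A²+3B²))
  2∣Nβ : + 2 Signed.∣ N β
  2∣Nβ = Signed.divides q (trans Nβ≡2q (ℤ.*-comm (+ 2) q))
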